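{- For every finite NAA $S=(S,S^0,\mathrm{Tran})$ over a finite alphabet $\Sigma$, $[\![S]\!]=[\![\mathrm{bh}(S)]\!]$, where $\mathrm{bh}(S)$ is the $\nu$HML formula $(S,S^0,\Delta_{\mathrm{Tran}})$ whose variables are the states of $S$ and $$\Delta_{\mathrm{Tran}}(s)=\bigvee_{M\in\mathrm{Tran}(s)}\Big(\bigwedge_{(a,t)\in M}\langle a\rangle t\ \wedge\ \bigwedge_{a\in\Sigma}[a]\Big(\bigvee_{u\in M_a}u\Big)\Big),$$ with $M_a=\{u\mid (a,u)\in M\}$.
   Context: An LTS is $(I,i^0,\to)$ with image-finite $\to\subseteq I\times\Sigma\times I$. A NAA is $(S,S^0,\mathrm{Tran})$ with $S^0\subseteq S$ finite and $\mathrm{Tran}:S\to 2^{\mathcal P_{\mathrm{fin}}(\Sigma\times S)}$; it is finite if $S$ is finite. NAA modal refinement $R\subseteq S_1\times S_2$: for $(s_1,s_2)\in R$ and $M_1\in\mathrm{Tran}_1(s_1)$ there is $M_2\in\mathrm{Tran}_2(s_2)$ such that each $(a,t_1)\in M_1$ has some $(a,t_2)\in M_2$ with $(t_1,t_2)\in R$ and each $(a,t_2)\in M_2$ has some $(a,t_1)\in M_1$ with $(t_1,t_2)\in R$; initialised if each initial state on the left is related to some initial state on the right. An LTS is identified with the NAA with initial set $\{i^0\}$ and $\mathrm{Tran}(s)=\{\{(a,t)\mid s\xrightarrow a t\}\}$; $[\![S]\!]$ is the set of LTS admitting an initialised modal refinement into $S$. $\nu$HML: HML formulae over variables $X$: $\phi::=\mathbf{tt}\mid\mathbf{ff}\mid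 x\mid\phi\wedge\phi\mid\phi\vee\phi\mid\langle a\rangle\phi\mid[a]\phi$ (empty disjunction is $\mathbf{ff}$, empty conjunction $\mathbf{tt}$). For an LTS with state set $I$ and assignment $\sigma:X\to 2^I$: $[\![\mathbf{tt}]\!]\sigma=I$, $[\![\mathbf{ff}]\!]\sigma=\emptyset$, $[\![x]\!]\sigma=\sigma(x)$, $\wedge/\vee$ as $\cap/\cup$, $[\![\langle a\rangle\phi]\!]\sigma=\{i\mid\exists i\xrightarrow a i', i'\in[\![\phi]\!]\sigma\}$, $[\![[a]\phi]\!]\sigma=\{i\mid\forall i\xrightarrow a i', i'\in[\![\phi]\!]\sigma\}$. For $\Delta:X\to\mathrm{HML}(X)$, $[\![\Delta]\!]$ is the greatest $\sigma$ with $\sigma(x)\subseteq[\![\Delta(x)]\!]\sigma$ for all $x$. A $\nu$HML formula $(X,X^0,\Delta)$ ($X^0\subseteq X$ finite) is implemented by an LTS iff $i^0\in[\![\Delta]\!](x^0)$ for some $x^0\in X^0$; its implementation set is also written $[\![\cdot]\!]$. -}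

module Defs where

open import Level using (Level; _⊔_) renaming (suc to lsuc; zero to lzero)
open import Data.Nat using (ℕ)
open import Data.Fin using (Fin; _≟_)
open import Data.Fin.Base using ()
open import Data.List using (List; []; _∷_; map; foldr; filter)
open import Data.List.Base using ()
open import Data.List.Membership.Propositional using (_∈_)
open import Data.List.Relation.Unary.Any using (Any)
open import Data.Product using (Σ; ∃; ∃-syntax; _×_; _,_; proj₁; proj₂)
open import Data.Sum using (_⊎_)
open import Data.Unit.Polymorphic using (⊤)
open import Data.Empty.Polymorphic using (⊥)
open import Relation.Binary.PropositionalEquality using (_≡_)
import Data.Fin as F
open import Data.List using (allFin)

-- Nondeterministic acceptance automata (general, possibly infinite)
-- Finite sets of (letter, state) pairs are represented by lists
-- (only membership is ever used).

record NAA (k : ℕ) : Set₁ where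
  field
    State : Set
    Init  : List State
    Tran  : State → List (Fin k × State) → Set

record LTS (k : ℕ) : Set₁ where
  field
    I    : Set
    i⁰   : I
    succ : I → List (Fin k × I)

  _⟶[_]_ : I → Fin k → I → Set
  i ⟶[ a ] i' = (a , i') ∈ succ i

ltsToNAA : ∀ {k} → LTS k → NAA k
ltsToNAA L = record
  { State = I
  ; Init  = i⁰ ∷ []
  ; Tran  = λ i M → M ≡ succ i
  }
  where open LTS L

IsModalRefinement : ∀ {k} (N₁ N₂ : NAA k) →
  (NAA.State N₁ → NAA.State N₂ → Set) → Set
IsModalRefinement {k} N₁ N₂ R =
  ∀ s₁ s₂ → R s₁ s₂ → ∀ M₁ → NAA.Tran N₁ s₁ M₁ →
    ∃[ M₂ ] (NAA.Tran N₂ s₂ M₂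
      × (∀ (a : Fin k) t₁ → (a , t₁) ∈ M₁ → ∃[ t₂ ] ((a , t₂) ∈ M₂ × R t₁ t₂))
      × (∀ (a : Fin k) t₂ → (a , t₂) ∈ M₂ → ∃[ t₁ ] ((a , t₁) ∈ M₁ × R t₁ t₂)))

IsInitialised : ∀ {k} (N₁ N₂ : NAA k) →
  (NAA.State N₁ → NAA.State N₂ → Set) → Set
IsInitialised N₁ N₂ R =
  ∀ s₁ → s₁ ∈ NAA.Init N₁ → ∃[ s₂ ] (s₂ ∈ NAA.Init N₂ × R s₁ s₂)

_≤m_ : ∀ {k} → NAA k → NAA k → Set₁
N₁ ≤m N₂ = Σ (NAA.State N₁ → NAA.State N₂ → Set) λ R →
  IsModalRefinement N₁ N₂ R × IsInitialised N₁ N₂ R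

⟦_⟧NAA : ∀ {k} → NAA k → LTS k → Set₁
⟦ N ⟧NAA L = ltsToNAA L ≤m N

record FinNAA (k : ℕ) : Set where
  field
    n    : ℕ
    init : List (Fin n)
    tran : Fin n → List (List (Fin k × Fin n))

finToNAA : ∀ {k} → FinNAA k → NAA k
finToNAA S = record
  { State = Fin n
  ; Init  = init
  ; Tran  = λ s M → M ∈ tran s
  }
  where open FinNAA S

data HML (k : ℕ) (X : Set) : Set where
  tt ff : HML k X
  var   : X → HML k X
  _∧_ _∨_ : HML k X → HML k X → HML k X
  ⟨_⟩_ : Fin k → HML k X → HML k X
  [_]_ : Fin k → HML k X → HML k X

⋀ : ∀ {k X} → List (HML k X) → HML k X
⋀ = foldr _∧_ tt

⋁ : ∀ {k X} → List (HML k X) → HML k X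
⋁ = foldr _∨_ ff

⟦_⟧ : ∀ {k X} → HML k X → (L : LTS k) → (X → LTS.I L → Set) → LTS.I L → Set
⟦ tt ⟧ L σ i = ⊤
⟦ ff ⟧ L σ i = ⊥
⟦ var x ⟧ L σ i = σ x i
⟦ φ ∧ ψ ⟧ L σ i = ⟦ φ ⟧ L σ i × ⟦ ψ ⟧ L σ i
⟦ φ ∨ ψ ⟧ L σ i = ⟦ φ ⟧ L σ i ⊎ ⟦ ψ ⟧ L σ i
⟦ ⟨ a ⟩ φ ⟧ L σ i = ∃[ i' ] (LTS._⟶[_]_ L i a i' × ⟦ φ ⟧ L σ i')
⟦ [ a ] φ ⟧ L σ i = ∀ i' → LTS._⟶[_]_ L i a i' → ⟦ φ ⟧ L σ i'

IsPostFixed : ∀ {k X} (L : LTS k) → (X → HML k X) → (X → LTS.I L → Set) → Set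
IsPostFixed L Δ σ = ∀ x i → σ x i → ⟦ Δ x ⟧ L σ i

-- [[Δ]] : the greatest post-fixed point, i.e. the union of all post-fixed points
⟦_⟧ν : ∀ {k X} → (X → HML k X) → (L : LTS k) → X → LTS.I L → Set₁
⟦ Δ ⟧ν L x i = Σ (_ → LTS.I L → Set) λ σ → IsPostFixed L Δ σ × σ x i

record νHML (k : ℕ) : Set₁ where
  field
    X  : Set
    X⁰ : List X
    Δ  : X → HML k X

⟦_⟧νHML : ∀ {k} → νHML k → LTS k → Set₁
⟦ φ ⟧νHML L = ∃[ x⁰ ] (x⁰ ∈ νHML.X⁰ φ × ⟦ νHML.Δ φ ⟧ν L x⁰ (LTS.i⁰ L))

_↾_ : ∀ {k m} → List (Fin k × Fin m) → Fin k → List (Fin m)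
M ↾ a = map proj₂ (filter (λ p → proj₁ p ≟ a) M)

Δ-Tran : ∀ {k} (S : FinNAA k) → Fin (FinNAA.n S) → HML k (Fin (FinNAA.n S))
Δ-Tran {k} S s =
  ⋁ (map (λ M → ⋀ (map (λ p → ⟨ proj₁ p ⟩ var (proj₂ p)) M)
               ∧ ⋀ (map (λ a → [ a ] ⋁ (map var (M ↾ a))) (allFin k)))
         (FinNAA.tran S s))

bh : ∀ {k} → FinNAA k → νHML k
bh S = record { X = Fin (FinNAA.n S) ; X⁰ = FinNAA.init S ; Δ = Δ-Tran S }

-- A post-fixed point σ of Δ_Tran and a modal refinement R of an LTS into S are the same
-- thing read in opposite directions (σ s i ⟺ R i s): unfolding the semantics of the
-- disjunct of Δ_Tran(s) chosen for M, its diamonds say that every (a , t) ∈ M is matched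
-- by an a-successor of i, and its boxes that every a-successor of i is matched by some
-- (a , u) ∈ M, which are exactly the two clauses of modal refinement with M₁ = succ i.
-- The initial conditions agree since the LTS has the single initial state i⁰.
module Submission where

open import Defs
open import Data.Nat using (ℕ)
open import Data.Fin using (Fin; _≟_)
open import Data.List using (List; []; _∷_; map; allFin)
open import Data.List.Membership.Propositional using (_∈_; find; lose)
open import Data.List.Membership.Propositional.Properties
  using (∈-allFin; ∈-map⁺; ∈-map⁻; ∈-filter⁺; ∈-filter⁻)
open import Data.List.Relation.Unary.Any using (Any; here; there)
open import Data.List.Relation.Unary.All using (All; []; _∷_; lookup; tabulate)
import Data.List.Relation.Unary.Any.Properties as Any
import Data.List.Relation.Unary.All.Properties as All
open import Data.Product using (∃-syntax; _×_; _,_; proj₁; proj₂)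
open import Data.Sum using (inj₁; inj₂)
open import Function.Base using (flip)
open import Function.Bundles using (_⇔_; mk⇔; module Equivalence)
open import Relation.Binary.PropositionalEquality using (refl)

open Equivalence using (to; from)

module _ {k : ℕ} {X : Set} (L : LTS k) (σ : X → LTS.I L → Set) where

  ⟦⋁⟧⇔Any : ∀ φs i → ⟦ ⋁ φs ⟧ L σ i ⇔ Any (λ φ → ⟦ φ ⟧ L σ i) φs
  ⟦⋁⟧⇔Any φs i = mk⇔ (⇒ φs) (⇐ φs)
    where
    ⇒ : ∀ φs → ⟦ ⋁ φs ⟧ L σ i → Any (λ φ → ⟦ φ ⟧ L σ i) φs
    ⇒ (φ ∷ φs) (inj₁ h) = here h
    ⇒ (φ ∷ φs) (inj₂ h) = there (⇒ φs h)

    ⇐ : ∀ φs → Any (λ φ → ⟦ φ ⟧ L σ i) φs → ⟦ ⋁ φs ⟧ L σ i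
    ⇐ (φ ∷ φs) (here h)  = inj₁ h
    ⇐ (φ ∷ φs) (there h) = inj₂ (⇐ φs h)

  ⟦⋀⟧⇔All : ∀ φs i → ⟦ ⋀ φs ⟧ L σ i ⇔ All (λ φ → ⟦ φ ⟧ L σ i) φs
  ⟦⋀⟧⇔All φs i = mk⇔ (⇒ φs) (⇐ φs)
    where
    ⇒ : ∀ φs → ⟦ ⋀ φs ⟧ L σ i → All (λ φ → ⟦ φ ⟧ L σ i) φs
    ⇒ []       _       = []
    ⇒ (φ ∷ φs) (h , hs) = h ∷ ⇒ φs hs

    ⇐ : ∀ φs → All (λ φ → ⟦ φ ⟧ L σ i) φs → ⟦ ⋀ φs ⟧ L σ i
    ⇐ []       []       = _
    ⇐ (φ ∷ φs) (h ∷ hs) = h , ⇐ φs hs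

  ⟦⋁-map⟧⇔ : ∀ {A : Set} (f : A → HML k X) xs i →
             ⟦ ⋁ (map f xs) ⟧ L σ i ⇔ (∃[ x ] (x ∈ xs × ⟦ f x ⟧ L σ i))
  ⟦⋁-map⟧⇔ f xs i = mk⇔
    (λ h → find (Any.map⁻ (to (⟦⋁⟧⇔Any (map f xs) i) h)))
    (λ (x , x∈xs , h) → from (⟦⋁⟧⇔Any (map f xs) i) (Any.map⁺ (lose x∈xs h)))

  ⟦⋀-map⟧⇔ : ∀ {A : Set} (f : A → HML k X) xs i →
             ⟦ ⋀ (map f xs) ⟧ L σ i ⇔ (∀ x → x ∈ xs → ⟦ f x ⟧ L σ i)
  ⟦⋀-map⟧⇔ f xs i = mk⇔
    (λ h x x∈xs → lookup (All.map⁻ (to (⟦⋀⟧⇔All (map f xs) i) h)) x∈xs)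
    (λ h → from (⟦⋀⟧⇔All (map f xs) i) (All.map⁺ (tabulate (h _))))

∈-↾⇔ : ∀ {k m} (M : List (Fin k × Fin m)) a u → u ∈ M ↾ a ⇔ (a , u) ∈ M
∈-↾⇔ M a u = mk⇔ ⇒ ⇐
  where
  ⇒ : u ∈ M ↾ a → (a , u) ∈ M
  ⇒ u∈M↾a with ∈-map⁻ proj₂ u∈M↾a
  ... | (b , v) , p∈ , refl with ∈-filter⁻ (λ p → proj₁ p ≟ a) p∈
  ...   | p∈M , refl = p∈M

  ⇐ : (a , u) ∈ M → u ∈ M ↾ a
  ⇐ au∈M = ∈-map⁺ proj₂ (∈-filter⁺ (λ p → proj₁ p ≟ a) au∈M refl)

module _ {k : ℕ} (S : FinNAA k) (L : LTS k) where
  open FinNAA S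
  open LTS L

  Covers : (I → Fin n → Set) → I → List (Fin k × Fin n) → Set
  Covers R i M = (∀ a t₁ → i ⟶[ a ] t₁ → ∃[ t₂ ] ((a , t₂) ∈ M × R t₁ t₂))
               × (∀ a t₂ → (a , t₂) ∈ M → ∃[ t₁ ] (i ⟶[ a ] t₁ × R t₁ t₂))

  -- Δ-Tran S s is definitionally ⋁ (map (λ M → diamonds M ∧ boxes M) (tran s)).
  diamonds boxes : List (Fin k × Fin n) → HML k (Fin n)
  diamonds M = ⋀ (map (λ p → ⟨ proj₁ p ⟩ var (proj₂ p)) M)
  boxes    M = ⋀ (map (λ a → [ a ] ⋁ (map var (M ↾ a))) (allFin k))

  ⟦diamonds⟧⇔ : ∀ σ i M → ⟦ diamonds M ⟧ L σ i ⇔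
                (∀ a t₂ → (a , t₂) ∈ M → ∃[ t₁ ] (i ⟶[ a ] t₁ × σ t₂ t₁))
  ⟦diamonds⟧⇔ σ i M = mk⇔
    (λ h a t₂ → to (⟦⋀-map⟧⇔ L σ _ M i) h (a , t₂))
    (λ h → from (⟦⋀-map⟧⇔ L σ _ M i) (λ (a , t₂) → h a t₂))

  ⟦boxes⟧⇔ : ∀ σ i M → ⟦ boxes M ⟧ L σ i ⇔
             (∀ a t₁ → i ⟶[ a ] t₁ → ∃[ t₂ ] ((a , t₂) ∈ M × σ t₂ t₁))
  ⟦boxes⟧⇔ σ i M = mk⇔ ⇒ ⇐
    where
    ⇒ : ⟦ boxes M ⟧ L σ i → ∀ a t₁ → i ⟶[ a ] t₁ → ∃[ t₂ ] ((a , t₂) ∈ M × σ t₂ t₁)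
    ⇒ h a t₁ a-step with to (⟦⋁-map⟧⇔ L σ var (M ↾ a) t₁)
                            (to (⟦⋀-map⟧⇔ L σ _ (allFin k) i) h a (∈-allFin a) t₁ a-step)
    ... | t₂ , t₂∈M↾a , r = t₂ , to (∈-↾⇔ M a t₂) t₂∈M↾a , r

    ⇐ : (∀ a t₁ → i ⟶[ a ] t₁ → ∃[ t₂ ] ((a , t₂) ∈ M × σ t₂ t₁)) → ⟦ boxes M ⟧ L σ i
    ⇐ h = from (⟦⋀-map⟧⇔ L σ _ (allFin k) i) λ a _ t₁ a-step →
      let t₂ , at₂∈M , r = h a t₁ a-step
      in from (⟦⋁-map⟧⇔ L σ var (M ↾ a) t₁) (t₂ , from (∈-↾⇔ M a t₂) at₂∈M , r)

  ⟦Δ-Tran⟧⇔ : ∀ σ s i → ⟦ Δ-Tran S s ⟧ L σ i ⇔ (∃[ M ] (M ∈ tran s × Covers (flip σ) i M))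
  ⟦Δ-Tran⟧⇔ σ s i = mk⇔ ⇒ ⇐
    where
    ⇒ : ⟦ Δ-Tran S s ⟧ L σ i → ∃[ M ] (M ∈ tran s × Covers (flip σ) i M)
    ⇒ h with to (⟦⋁-map⟧⇔ L σ (λ M → diamonds M ∧ boxes M) (tran s) i) h
    ... | M , M∈ , d , b = M , M∈ , to (⟦boxes⟧⇔ σ i M) b , to (⟦diamonds⟧⇔ σ i M) d

    ⇐ : ∃[ M ] (M ∈ tran s × Covers (flip σ) i M) → ⟦ Δ-Tran S s ⟧ L σ i
    ⇐ (M , M∈ , forth , back) = from (⟦⋁-map⟧⇔ L σ (λ M → diamonds M ∧ boxes M) (tran s) i)
      (M , M∈ , from (⟦diamonds⟧⇔ σ i M) back , from (⟦boxes⟧⇔ σ i M) forth)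

  refinement⇔postFixed : ∀ R → IsModalRefinement (ltsToNAA L) (finToNAA S) R
                             ⇔ IsPostFixed L (Δ-Tran S) (flip R)
  refinement⇔postFixed R = mk⇔
    (λ ref s i r → from (⟦Δ-Tran⟧⇔ (flip R) s i) (ref i s r (succ i) refl))
    (λ { post i s r _ refl → to (⟦Δ-Tran⟧⇔ (flip R) s i) (post s i r) })

lemma2 : ∀ {k : ℕ} (S : FinNAA k) (L : LTS k) →
           ⟦ finToNAA S ⟧NAA L ⇔ ⟦ bh S ⟧νHML L
lemma2 S L = mk⇔ ⇒ ⇐
  where
  open LTS L

  ⇒ : ⟦ finToNAA S ⟧NAA L → ⟦ bh S ⟧νHML L
  ⇒ (R , ref , initialised) with initialised i⁰ (here refl)
  ... | s⁰ , s⁰∈ , r⁰ = s⁰ , s⁰∈ , flip R , to (refinement⇔postFixed S L R) ref , r⁰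

  ⇐ : ⟦ bh S ⟧νHML L → ⟦ finToNAA S ⟧NAA L
  ⇐ (x⁰ , x⁰∈ , σ , post , i⁰∈σx⁰) =
    flip σ , from (refinement⇔postFixed S L (flip σ)) post ,
    λ { _ (here refl) → x⁰ , x⁰∈ , i⁰∈σx⁰ }
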